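{- For positive integers $m$ and $n$, the optimal pegging number of $K_m\times K_n$ is \[ p(K_m\times K_n)=\begin{cases} 1 & \text{if } mn=1,\\ 2 & \text{if } mn>1 \text{ and } \min\{m,n\}\le 2,\\ 3 & \text{otherwise.}\end{cases} \]
   Context: $K_m$ is the complete graph on $m$ vertices; the Cartesian product $G\times H$ has vertex set $V(G)\times V(H)$, with $(g,h)$ adjacent to $(g',h')$ iff either $g=g'$ and $hh'\in E(H)$, or $h=h'$ and $gg'\in E(G)$. A distribution of pegs on a graph $\Gamma$ is a subset $D \subseteq V(\Gamma)$. If $u,v \in D$ are distinct adjacent vertices and $w \notin D$ is a vertex adjacent to $v$, the pegging move (jumping $u$ over $v$ into $w$) replaces $D$ by $(D\setminus\{u,v\})\cup\{w\}$. A vertex $t$ is reachable from $D$ if some finite (possibly empty) sequence of pegging moves starting from $D$ ends in a distribution containing $t$. The optimal pegging number $p(\Gamma)$ is the smallest positive integer $d$ such that some distribution of size $d$ on $\Gamma$ has every vertex reachable. -}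

module Defs where

open import Data.Nat using (ℕ; _*_; _≤_; _<_; _>_; zero; suc)
open import Data.Fin using (Fin; remQuot)
open import Data.Fin.Subset using (Subset; _∈_; _∉_; ∣_∣)
open import Data.Product using (Σ; ∃; _×_; _,_; proj₁; proj₂)
open import Relation.Binary.PropositionalEquality using (_≡_; _≢_)
open import Relation.Binary.Construct.Closure.ReflexiveTransitive using (Star)

record FinGraph : Set₁ where
  field
    N   : ℕ
    Adj : Fin N → Fin N → Set
open FinGraph public

K : ℕ → FinGraph
K m = record { N = m ; Adj = λ x y → x ≢ y }

_□_ : FinGraph → FinGraph → FinGraph
G □ H = record
  { N   = N G * N H
  ; Adj = λ x y →
      let (g  , h)  = remQuot {N G} (N H) x
          (g' , h') = remQuot {N G} (N H) y
      in (g ≡ g' × Adj H h h') ⊎' (h ≡ h' × Adj G g g')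
  }
  where
    open import Data.Sum using () renaming (_⊎_ to _⊎'_)

Distribution : FinGraph → Set
Distribution Γ = Subset (N Γ)

-- One pegging move: jump peg u over adjacent peg v into empty w adjacent to v.
-- D' = (D \ {u,v}) ∪ {w}.
data Move (Γ : FinGraph) (D D' : Distribution Γ) : Set where
  move : (u v w : Fin (N Γ)) →
         u ∈ D → v ∈ D → u ≢ v → Adj Γ u v → w ∉ D → Adj Γ v w →
         u ∉ D' → v ∉ D' → w ∈ D' →
         (∀ x → x ≢ u → x ≢ v → x ≢ w → (x ∈ D' → x ∈ D) × (x ∈ D → x ∈ D')) →
         Move Γ D D'

Reachable : (Γ : FinGraph) → Distribution Γ → Fin (N Γ) → Set
Reachable Γ D t = Σ (Distribution Γ) λ D' → Star (Move Γ) D D' × t ∈ D'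

Solvable : (Γ : FinGraph) → Distribution Γ → Set
Solvable Γ D = ∀ t → Reachable Γ D t

OptimalPeggingNumber : FinGraph → ℕ → Set
OptimalPeggingNumber Γ d =
  (0 < d) ×
  (Σ (Distribution Γ) λ D → (∣ D ∣ ≡ d) × Solvable Γ D) ×
  (∀ (D : Distribution Γ) → 0 < ∣ D ∣ → Solvable Γ D → d ≤ ∣ D ∣)

module Submission where

-- A single peg can never move, so one peg reaches only itself.  After one jump from two pegs
-- a, b only a single peg is left, sitting next to a or b; hence two pegs reach exactly the
-- closed neighbourhood of {a, b}, and conversely reach all of it when a and b are adjacent.
-- In K m × K n such a dominating edge exists (two cells of a row or column) precisely when
-- min(m, n) ≤ 2, while for m, n ≥ 3 every pair misses a cell in a third row and third column.
-- There three pegs in an L-shape reach everything in at most two jumps.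

open import Defs
open import Data.Nat using (ℕ; zero; suc; _+_; _*_; _≤_; _<_; _⊓_; z≤n; s≤s)
open import Data.Nat.Properties using (suc-injective; n≮0; ≤-trans; m⊓n≤m; m⊓n≤n; m*n≡1⇒m≡1; m*n≡1⇒n≡1)
open import Data.Fin using (Fin; zero; suc; combine; remQuot; _≟_)
open import Data.Fin.Properties using (combine-injectiveˡ; combine-injectiveʳ; combine-remQuot; remQuot-combine)
open import Data.Fin.Subset using (Subset; inside; outside; _∈_; _∉_; _⊆_; ∣_∣; ⁅_⁆; _∪_; _-_)
open import Data.Fin.Subset.Properties
  using (x∈⁅x⁆; x∈⁅y⁆⇒x≡y; x≢y⇒x∉⁅y⁆; ∣⁅x⁆∣≡1; x∈p∪q⁺; x∈p∪q⁻; p─q⊆p; x∈p∧x≢y⇒x∈p-y; ∪-identityˡ)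
open import Data.Vec using (_∷_; here; there)
open import Data.Product using (_×_; _,_; proj₁; proj₂; ∃; ∃₂)
open import Data.Sum using (_⊎_; inj₁; inj₂; [_,_])
open import Function using (_∘_)
open import Data.Empty using (⊥; ⊥-elim)
open import Relation.Nullary using (¬_; yes; no)
open import Relation.Binary.PropositionalEquality using (_≡_; _≢_; refl; sym; trans; cong; subst; subst₂; ≢-sym)
open import Relation.Binary.Construct.Closure.ReflexiveTransitive using (ε; _◅_)

module _ {n : ℕ} {p : Subset n} {x y : Fin n} where

  x∈p-y⇒x∈p : x ∈ p - y → x ∈ p
  x∈p-y⇒x∈p = p─q⊆p p ⁅ y ⁆

  x∈⁅y⁆∪p⁻ : x ∈ ⁅ y ⁆ ∪ p → x ≡ y ⊎ x ∈ p
  x∈⁅y⁆∪p⁻ x∈ with x∈p∪q⁻ ⁅ y ⁆ p x∈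
  ... | inj₁ x∈⁅y⁆ = inj₁ (x∈⁅y⁆⇒x≡y y x∈⁅y⁆)
  ... | inj₂ x∈p   = inj₂ x∈p

  x≢y∧x∉p⇒x∉⁅y⁆∪p : x ≢ y → x ∉ p → x ∉ ⁅ y ⁆ ∪ p
  x≢y∧x∉p⇒x∉⁅y⁆∪p x≢y x∉p x∈ with x∈⁅y⁆∪p⁻ x∈
  ... | inj₁ x≡y = x≢y x≡y
  ... | inj₂ x∈p = x∉p x∈p

x∉p-x : ∀ {n} {p : Subset n} {x : Fin n} → x ∉ p - x
x∉p-x {p = _ ∷ _} {zero}  ()
x∉p-x {p = _ ∷ _} {suc x} (there x∈) = x∉p-x x∈

x∈⁅y⁆∪⁅z⁆⁻ : ∀ {n} {x y z : Fin n} → x ∈ ⁅ y ⁆ ∪ ⁅ z ⁆ → x ≡ y ⊎ x ≡ z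
x∈⁅y⁆∪⁅z⁆⁻ {z = z} x∈ with x∈⁅y⁆∪p⁻ x∈
... | inj₁ x≡y   = inj₁ x≡y
... | inj₂ x∈⁅z⁆ = inj₂ (x∈⁅y⁆⇒x≡y z x∈⁅z⁆)

¬three-distinct-∈⁅a⁆∪⁅b⁆ : ∀ {n} {a b x y z : Fin n} →
                            x ∈ ⁅ a ⁆ ∪ ⁅ b ⁆ → y ∈ ⁅ a ⁆ ∪ ⁅ b ⁆ → z ∈ ⁅ a ⁆ ∪ ⁅ b ⁆ →
                            x ≢ y → x ≢ z → y ≢ z → ⊥
¬three-distinct-∈⁅a⁆∪⁅b⁆ x∈ y∈ z∈ x≢y x≢z y≢z
  with x∈⁅y⁆∪⁅z⁆⁻ x∈ | x∈⁅y⁆∪⁅z⁆⁻ y∈ | x∈⁅y⁆∪⁅z⁆⁻ z∈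
... | inj₁ refl | inj₁ refl | _         = x≢y refl
... | inj₁ refl | inj₂ refl | inj₁ refl = x≢z refl
... | inj₁ refl | inj₂ refl | inj₂ refl = y≢z refl
... | inj₂ refl | inj₂ refl | _         = x≢y refl
... | inj₂ refl | inj₁ refl | inj₂ refl = x≢z refl
... | inj₂ refl | inj₁ refl | inj₁ refl = y≢z refl

x∉p⇒∣⁅x⁆∪p∣≡1+∣p∣ : ∀ {n} {x : Fin n} {p : Subset n} → x ∉ p → ∣ ⁅ x ⁆ ∪ p ∣ ≡ suc ∣ p ∣
x∉p⇒∣⁅x⁆∪p∣≡1+∣p∣ {x = zero}  {inside  ∷ p} x∉p = ⊥-elim (x∉p here)
x∉p⇒∣⁅x⁆∪p∣≡1+∣p∣ {x = zero}  {outside ∷ p} _   = cong (λ q → suc ∣ q ∣) (∪-identityˡ p)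
x∉p⇒∣⁅x⁆∪p∣≡1+∣p∣ {x = suc x} {inside  ∷ p} x∉p = cong suc (x∉p⇒∣⁅x⁆∪p∣≡1+∣p∣ (λ x∈p → x∉p (there x∈p)))
x∉p⇒∣⁅x⁆∪p∣≡1+∣p∣ {x = suc x} {outside ∷ p} x∉p = x∉p⇒∣⁅x⁆∪p∣≡1+∣p∣ (λ x∈p → x∉p (there x∈p))

∣⁅x⁆∪⁅y⁆∣≡2 : ∀ {n} {x y : Fin n} → x ≢ y → ∣ ⁅ x ⁆ ∪ ⁅ y ⁆ ∣ ≡ 2
∣⁅x⁆∪⁅y⁆∣≡2 {y = y} x≢y = trans (x∉p⇒∣⁅x⁆∪p∣≡1+∣p∣ (x≢y⇒x∉⁅y⁆ x≢y)) (cong suc (∣⁅x⁆∣≡1 y))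

∣p∣≡0⇒x∉p : ∀ {n} {p : Subset n} {x : Fin n} → ∣ p ∣ ≡ 0 → x ∉ p
∣p∣≡0⇒x∉p {p = inside  ∷ _} ()
∣p∣≡0⇒x∉p {p = outside ∷ _} ∣p∣≡0 (there x∈p) = ∣p∣≡0⇒x∉p ∣p∣≡0 x∈p

∣p∣≡1⇒p⊆⁅x⁆ : ∀ {n} (p : Subset n) → ∣ p ∣ ≡ 1 → ∃ λ x → p ⊆ ⁅ x ⁆
∣p∣≡1⇒p⊆⁅x⁆ (inside ∷ p) ∣p∣≡1 =
  zero , λ { here → here ; (there x∈p) → ⊥-elim (∣p∣≡0⇒x∉p (suc-injective ∣p∣≡1) x∈p) }
∣p∣≡1⇒p⊆⁅x⁆ (outside ∷ p) ∣p∣≡1 with ∣p∣≡1⇒p⊆⁅x⁆ p ∣p∣≡1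
... | x , p⊆⁅x⁆ = suc x , λ { (there y∈p) → there (p⊆⁅x⁆ y∈p) }

∣p∣≡2⇒p⊆⁅x⁆∪⁅y⁆ : ∀ {n} (p : Subset n) → ∣ p ∣ ≡ 2 → ∃₂ λ x y → p ⊆ ⁅ x ⁆ ∪ ⁅ y ⁆
∣p∣≡2⇒p⊆⁅x⁆∪⁅y⁆ (inside ∷ p) ∣p∣≡2 with ∣p∣≡1⇒p⊆⁅x⁆ p (suc-injective ∣p∣≡2)
... | y , p⊆⁅y⁆ = zero , suc y , λ { here → here ; (there z∈p) → there (x∈p∪q⁺ (inj₂ (p⊆⁅y⁆ z∈p))) }
∣p∣≡2⇒p⊆⁅x⁆∪⁅y⁆ (outside ∷ p) ∣p∣≡2 with ∣p∣≡2⇒p⊆⁅x⁆∪⁅y⁆ p ∣p∣≡2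
... | x , y , p⊆⁅x⁆∪⁅y⁆ = suc x , suc y , λ { (there z∈p) → there (p⊆⁅x⁆∪⁅y⁆ z∈p) }

∃≢₂ : ∀ {k} → 3 ≤ k → (a b : Fin k) → ∃ λ c → c ≢ a × c ≢ b
∃≢₂ (s≤s (s≤s (s≤s _))) (suc _)       (suc _)       = zero , (λ ()) , (λ ())
∃≢₂ (s≤s (s≤s (s≤s _))) zero          zero          = suc zero , (λ ()) , (λ ())
∃≢₂ (s≤s (s≤s (s≤s _))) zero          (suc zero)    = suc (suc zero) , (λ ()) , (λ ())
∃≢₂ (s≤s (s≤s (s≤s _))) zero          (suc (suc _)) = suc zero , (λ ()) , (λ ())
∃≢₂ (s≤s (s≤s (s≤s _))) (suc zero)    zero          = suc (suc zero) , (λ ()) , (λ ())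
∃≢₂ (s≤s (s≤s (s≤s _))) (suc (suc _)) zero          = suc zero , (λ ()) , (λ ())

module Pegging (Γ : FinGraph) where

  private
    V : Set
    V = Fin (N Γ)

  jump : Distribution Γ → V → V → V → Distribution Γ
  jump D u v w = ⁅ w ⁆ ∪ (D - u - v)

  module _ {D : Distribution Γ} {u v w x : V} where

    ∈jump⁻ : x ∈ jump D u v w → x ≡ w ⊎ (x ∈ D × x ≢ u × x ≢ v)
    ∈jump⁻ x∈ with x∈⁅y⁆∪p⁻ x∈
    ... | inj₁ x≡w     = inj₁ x≡w
    ... | inj₂ x∈D-u-v =
      inj₂ (x∈p-y⇒x∈p (x∈p-y⇒x∈p x∈D-u-v) , (λ { refl → x∉p-x (x∈p-y⇒x∈p x∈D-u-v) }) , λ { refl → x∉p-x x∈D-u-v })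

    ∈jump⁺ : x ∈ D → x ≢ u → x ≢ v → x ∈ jump D u v w
    ∈jump⁺ x∈D x≢u x≢v = x∈p∪q⁺ (inj₂ (x∈p∧x≢y⇒x∈p-y (x∈p∧x≢y⇒x∈p-y x∈D x≢u) x≢v))

    ∈jump∧≢⇒∈ : x ∈ jump D u v w → x ≢ w → x ∈ D
    ∈jump∧≢⇒∈ x∈ x≢w with ∈jump⁻ x∈
    ... | inj₁ x≡w           = ⊥-elim (x≢w x≡w)
    ... | inj₂ (x∈D , _ , _) = x∈D

  w∈jump : ∀ {D u v w} → w ∈ jump D u v w
  w∈jump {w = w} = x∈p∪q⁺ (inj₁ (x∈⁅x⁆ w))

  jump-move : ∀ {D u v w} → u ∈ D → v ∈ D → u ≢ v → Adj Γ u v → w ∉ D → Adj Γ v w →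
              Move Γ D (jump D u v w)
  jump-move {D} {u} {v} {w} u∈D v∈D u≢v u~v w∉D v~w =
    move u v w u∈D v∈D u≢v u~v w∉D v~w u∉ v∉ w∈jump
      (λ x x≢u x≢v x≢w → (λ x∈ → ∈jump∧≢⇒∈ x∈ x≢w) , λ x∈D → ∈jump⁺ x∈D x≢u x≢v)
    where
    u∉ : u ∉ jump D u v w
    u∉ u∈ with ∈jump⁻ u∈
    ... | inj₁ refl            = w∉D u∈D
    ... | inj₂ (_ , u≢u , _)   = u≢u refl
    v∉ : v ∉ jump D u v w
    v∉ v∈ with ∈jump⁻ v∈
    ... | inj₁ refl            = w∉D v∈D
    ... | inj₂ (_ , _ , v≢v)   = v≢v refl

  jump-reachable : ∀ {D u v w} → u ∈ D → v ∈ D → u ≢ v → Adj Γ u v → w ∉ D → Adj Γ v w →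
                   Reachable Γ D w
  jump-reachable {D} {u} {v} {w} u∈D v∈D u≢v u~v w∉D v~w =
    jump D u v w , jump-move u∈D v∈D u≢v u~v w∉D v~w ◅ ε , w∈jump

  InClosedNbhd : V → V → V → Set
  InClosedNbhd a b t = t ≡ a ⊎ t ≡ b ⊎ Adj Γ a t ⊎ Adj Γ b t

  module _ {D D' : Distribution Γ} where

    ⊆⁅a⁆⇒¬Move : ∀ {a} → D ⊆ ⁅ a ⁆ → ¬ Move Γ D D'
    ⊆⁅a⁆⇒¬Move {a} D⊆⁅a⁆ (move u v _ u∈D v∈D u≢v _ _ _ _ _ _ _) =
      u≢v (trans (x∈⁅y⁆⇒x≡y a (D⊆⁅a⁆ u∈D)) (sym (x∈⁅y⁆⇒x≡y a (D⊆⁅a⁆ v∈D))))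

    ⊆⁅a⁆∪⁅b⁆∧Move⇒⊆⁅w⁆ : ∀ {a b} → D ⊆ ⁅ a ⁆ ∪ ⁅ b ⁆ → Move Γ D D' →
                          ∃ λ w → D' ⊆ ⁅ w ⁆ × (Adj Γ a w ⊎ Adj Γ b w)
    ⊆⁅a⁆∪⁅b⁆∧Move⇒⊆⁅w⁆ {a} {b} D⊆ (move u v w u∈D v∈D u≢v _ _ v~w u∉D' v∉D' _ frame) =
      w , D'⊆⁅w⁆ , jumped-from (x∈⁅y⁆∪⁅z⁆⁻ (D⊆ v∈D))
      where
      jumped-from : v ≡ a ⊎ v ≡ b → Adj Γ a w ⊎ Adj Γ b w
      jumped-from (inj₁ refl) = inj₁ v~w
      jumped-from (inj₂ refl) = inj₂ v~w
      D'⊆⁅w⁆ : D' ⊆ ⁅ w ⁆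
      D'⊆⁅w⁆ {x} x∈D' with x ≟ w | x ≟ u | x ≟ v
      ... | yes refl | _        | _        = x∈⁅x⁆ w
      ... | no _     | yes refl | _        = ⊥-elim (u∉D' x∈D')
      ... | no _     | no _     | yes refl = ⊥-elim (v∉D' x∈D')
      ... | no x≢w   | no x≢u   | no x≢v   =
        ⊥-elim (¬three-distinct-∈⁅a⁆∪⁅b⁆ (D⊆ (proj₁ (frame x x≢u x≢v x≢w) x∈D')) (D⊆ u∈D) (D⊆ v∈D) x≢u x≢v u≢v)

  reachable-from-⊆⁅a⁆ : ∀ {a D t} → D ⊆ ⁅ a ⁆ → Reachable Γ D t → t ≡ a
  reachable-from-⊆⁅a⁆ {a} D⊆⁅a⁆ (_ , ε , t∈D)     = x∈⁅y⁆⇒x≡y a (D⊆⁅a⁆ t∈D)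
  reachable-from-⊆⁅a⁆ D⊆⁅a⁆ (_ , D→D' ◅ _ , _) = ⊥-elim (⊆⁅a⁆⇒¬Move D⊆⁅a⁆ D→D')

  reachable-from-⊆⁅a⁆∪⁅b⁆ : ∀ {a b D t} → D ⊆ ⁅ a ⁆ ∪ ⁅ b ⁆ → Reachable Γ D t → InClosedNbhd a b t
  reachable-from-⊆⁅a⁆∪⁅b⁆ D⊆ (_ , ε , t∈D) with x∈⁅y⁆∪⁅z⁆⁻ (D⊆ t∈D)
  ... | inj₁ t≡a = inj₁ t≡a
  ... | inj₂ t≡b = inj₂ (inj₁ t≡b)
  reachable-from-⊆⁅a⁆∪⁅b⁆ D⊆ (D'' , D→D' ◅ D'→D'' , t∈D'') with ⊆⁅a⁆∪⁅b⁆∧Move⇒⊆⁅w⁆ D⊆ D→D'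
  ... | w , D'⊆⁅w⁆ , w-adjacent with reachable-from-⊆⁅a⁆ D'⊆⁅w⁆ (D'' , D'→D'' , t∈D'')
  ...   | refl = inj₂ (inj₂ w-adjacent)

  solvable⇒2≤∣D∣ : ∀ {x y} → x ≢ y → (D : Distribution Γ) → 0 < ∣ D ∣ → Solvable Γ D → 2 ≤ ∣ D ∣
  solvable⇒2≤∣D∣ {x} {y} x≢y D 0<∣D∣ solvable with ∣ D ∣ in ∣D∣≡
  ... | 0           = ⊥-elim (n≮0 0<∣D∣)
  ... | suc (suc _) = s≤s (s≤s z≤n)
  ... | 1 with ∣p∣≡1⇒p⊆⁅x⁆ D ∣D∣≡
  ...   | a , D⊆⁅a⁆ =
    ⊥-elim (x≢y (trans (reachable-from-⊆⁅a⁆ D⊆⁅a⁆ (solvable x)) (sym (reachable-from-⊆⁅a⁆ D⊆⁅a⁆ (solvable y)))))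

  ⊆⁅a⁆∪⁅b⁆⇒¬Solvable : ∀ {a b} {D : Distribution Γ} → (∃ λ t → ¬ InClosedNbhd a b t) →
                       D ⊆ ⁅ a ⁆ ∪ ⁅ b ⁆ → ¬ Solvable Γ D
  ⊆⁅a⁆∪⁅b⁆⇒¬Solvable (t , t∉N) D⊆ solvable = t∉N (reachable-from-⊆⁅a⁆∪⁅b⁆ D⊆ (solvable t))

  solvable⇒3≤∣D∣ : (∀ a b → ∃ λ t → ¬ InClosedNbhd a b t) →
                   (D : Distribution Γ) → 0 < ∣ D ∣ → Solvable Γ D → 3 ≤ ∣ D ∣
  solvable⇒3≤∣D∣ undominated D 0<∣D∣ solvable with ∣ D ∣ in ∣D∣≡
  ... | 0                 = ⊥-elim (n≮0 0<∣D∣)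
  ... | suc (suc (suc _)) = s≤s (s≤s (s≤s z≤n))
  ... | 1 with ∣p∣≡1⇒p⊆⁅x⁆ D ∣D∣≡
  ...   | a , D⊆⁅a⁆ =
    ⊥-elim (⊆⁅a⁆∪⁅b⁆⇒¬Solvable (undominated a a) (λ x∈D → x∈p∪q⁺ (inj₁ (D⊆⁅a⁆ x∈D))) solvable)
  solvable⇒3≤∣D∣ undominated D 0<∣D∣ solvable | 2 with ∣p∣≡2⇒p⊆⁅x⁆∪⁅y⁆ D ∣D∣≡
  ...   | a , b , D⊆ = ⊥-elim (⊆⁅a⁆∪⁅b⁆⇒¬Solvable (undominated a b) D⊆ solvable)

  module _ {a b : V} (a≢b : a ≢ b) (a~b : Adj Γ a b) (b~a : Adj Γ b a) where

    private
      a∈ : a ∈ ⁅ a ⁆ ∪ ⁅ b ⁆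
      a∈ = x∈p∪q⁺ (inj₁ (x∈⁅x⁆ a))

      b∈ : b ∈ ⁅ a ⁆ ∪ ⁅ b ⁆
      b∈ = x∈p∪q⁺ (inj₂ (x∈⁅x⁆ b))

      ∉⁅a⁆∪⁅b⁆ : ∀ {t} → t ≢ a → t ≢ b → t ∉ ⁅ a ⁆ ∪ ⁅ b ⁆
      ∉⁅a⁆∪⁅b⁆ t≢a t≢b = x≢y∧x∉p⇒x∉⁅y⁆∪p t≢a (x≢y⇒x∉⁅y⁆ t≢b)

    ⁅a⁆∪⁅b⁆-solvable : (∀ t → InClosedNbhd a b t) → Solvable Γ (⁅ a ⁆ ∪ ⁅ b ⁆)
    ⁅a⁆∪⁅b⁆-solvable dominating t with t ≟ a | t ≟ b | dominating t
    ... | yes refl | _        | _                      = _ , ε , a∈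
    ... | no _     | yes refl | _                      = _ , ε , b∈
    ... | no t≢a   | no _     | inj₁ t≡a               = ⊥-elim (t≢a t≡a)
    ... | no _     | no t≢b   | inj₂ (inj₁ t≡b)        = ⊥-elim (t≢b t≡b)
    ... | no t≢a   | no t≢b   | inj₂ (inj₂ (inj₁ a~t)) = jump-reachable b∈ a∈ (≢-sym a≢b) b~a (∉⁅a⁆∪⁅b⁆ t≢a t≢b) a~t
    ... | no t≢a   | no t≢b   | inj₂ (inj₂ (inj₂ b~t)) = jump-reachable a∈ b∈ a≢b a~b (∉⁅a⁆∪⁅b⁆ t≢a t≢b) b~t

    dominating-edge⇒p≡2 : (∀ t → InClosedNbhd a b t) → OptimalPeggingNumber Γ 2
    dominating-edge⇒p≡2 dominating =
      s≤s z≤n , (⁅ a ⁆ ∪ ⁅ b ⁆ , ∣⁅x⁆∪⁅y⁆∣≡2 a≢b , ⁅a⁆∪⁅b⁆-solvable dominating) , solvable⇒2≤∣D∣ a≢b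

  no-dominating-pair⇒p≡3 : (∀ a b → ∃ λ t → ¬ InClosedNbhd a b t) →
                           (D : Distribution Γ) → ∣ D ∣ ≡ 3 → Solvable Γ D → OptimalPeggingNumber Γ 3
  no-dominating-pair⇒p≡3 undominated D ∣D∣≡3 solvable =
    s≤s z≤n , (D , ∣D∣≡3 , solvable) , solvable⇒3≤∣D∣ undominated

module Rook {m n : ℕ} where

  open Pegging (K m □ K n)

  -- Kept opaque so that Agda can read g and h off ⟨ g , h ⟩ instead of unfolding combine.
  opaque
    ⟨_,_⟩ : Fin m → Fin n → Fin (m * n)
    ⟨_,_⟩ = combine

  opaque
    unfolding ⟨_,_⟩

    ⟨,⟩-elim : {P : Fin (m * n) → Set} → (∀ g h → P ⟨ g , h ⟩) → ∀ t → P t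
    ⟨,⟩-elim {P} P⟨,⟩ t = subst P (combine-remQuot {m} n t) (P⟨,⟩ _ _)

    private
      row-⟨,⟩ : ∀ g h → proj₁ (remQuot {m} n ⟨ g , h ⟩) ≡ g
      row-⟨,⟩ g h = cong proj₁ (remQuot-combine g h)

      col-⟨,⟩ : ∀ g h → proj₂ (remQuot {m} n ⟨ g , h ⟩) ≡ h
      col-⟨,⟩ g h = cong proj₂ (remQuot-combine g h)

    ⟨,⟩-≢ˡ : ∀ {g g' h h'} → g ≢ g' → ⟨ g , h ⟩ ≢ ⟨ g' , h' ⟩
    ⟨,⟩-≢ˡ {g} {g'} {h} {h'} g≢g' eq = g≢g' (combine-injectiveˡ g h g' h' eq)

    ⟨,⟩-≢ʳ : ∀ {g g' h h'} → h ≢ h' → ⟨ g , h ⟩ ≢ ⟨ g' , h' ⟩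
    ⟨,⟩-≢ʳ {g} {g'} {h} {h'} h≢h' eq = h≢h' (combine-injectiveʳ g h g' h' eq)

  □-adj⇒≡ˡ⊎≡ʳ : ∀ {g g' h h'} → Adj (K m □ K n) ⟨ g , h ⟩ ⟨ g' , h' ⟩ → g ≡ g' ⊎ h ≡ h'
  □-adj⇒≡ˡ⊎≡ʳ {g} {g'} {h} {h'} (inj₁ (rows≡ , _)) = inj₁ (subst₂ _≡_ (row-⟨,⟩ g h) (row-⟨,⟩ g' h') rows≡)
  □-adj⇒≡ˡ⊎≡ʳ {g} {g'} {h} {h'} (inj₂ (cols≡ , _)) = inj₂ (subst₂ _≡_ (col-⟨,⟩ g h) (col-⟨,⟩ g' h') cols≡)

  □-adjʳ : ∀ g {h h'} → h ≢ h' → Adj (K m □ K n) ⟨ g , h ⟩ ⟨ g , h' ⟩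
  □-adjʳ g {h} {h'} h≢h' =
    inj₁ (subst₂ _≡_ (sym (row-⟨,⟩ g h)) (sym (row-⟨,⟩ g h')) refl ,
          λ cols≡ → h≢h' (subst₂ _≡_ (col-⟨,⟩ g h) (col-⟨,⟩ g h') cols≡))

  □-adjˡ : ∀ {g g'} h → g ≢ g' → Adj (K m □ K n) ⟨ g , h ⟩ ⟨ g' , h ⟩
  □-adjˡ {g} {g'} h g≢g' =
    inj₂ (subst₂ _≡_ (sym (col-⟨,⟩ g h)) (sym (col-⟨,⟩ g' h)) refl ,
          λ rows≡ → g≢g' (subst₂ _≡_ (row-⟨,⟩ g h) (row-⟨,⟩ g' h) rows≡))

  row-pair-dominating : ∀ {g₀ h₀ h₁} → (∀ g h → g ≡ g₀ ⊎ h ≡ h₀ ⊎ h ≡ h₁) →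
                        ∀ t → InClosedNbhd ⟨ g₀ , h₀ ⟩ ⟨ g₀ , h₁ ⟩ t
  row-pair-dominating {g₀} {h₀} {h₁} covered = ⟨,⟩-elim dominated
    where
    dominated : ∀ g h → InClosedNbhd ⟨ g₀ , h₀ ⟩ ⟨ g₀ , h₁ ⟩ ⟨ g , h ⟩
    dominated g h with covered g h
    ... | inj₁ refl with h ≟ h₀
    ...   | yes refl = inj₁ refl
    ...   | no h≢h₀  = inj₂ (inj₂ (inj₁ (□-adjʳ g₀ (≢-sym h≢h₀))))
    dominated g h | inj₂ (inj₁ refl) with g ≟ g₀
    ...   | yes refl = inj₁ refl
    ...   | no g≢g₀  = inj₂ (inj₂ (inj₁ (□-adjˡ h₀ (≢-sym g≢g₀))))
    dominated g h | inj₂ (inj₂ refl) with g ≟ g₀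
    ...   | yes refl = inj₂ (inj₁ refl)
    ...   | no g≢g₀  = inj₂ (inj₂ (inj₂ (□-adjˡ h₁ (≢-sym g≢g₀))))

  col-pair-dominating : ∀ {g₀ g₁ h₀} → (∀ g h → h ≡ h₀ ⊎ g ≡ g₀ ⊎ g ≡ g₁) →
                        ∀ t → InClosedNbhd ⟨ g₀ , h₀ ⟩ ⟨ g₁ , h₀ ⟩ t
  col-pair-dominating {g₀} {g₁} {h₀} covered = ⟨,⟩-elim dominated
    where
    dominated : ∀ g h → InClosedNbhd ⟨ g₀ , h₀ ⟩ ⟨ g₁ , h₀ ⟩ ⟨ g , h ⟩
    dominated g h with covered g h
    ... | inj₁ refl with g ≟ g₀
    ...   | yes refl = inj₁ refl
    ...   | no g≢g₀  = inj₂ (inj₂ (inj₁ (□-adjˡ h₀ (≢-sym g≢g₀))))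
    dominated g h | inj₂ (inj₁ refl) with h ≟ h₀
    ...   | yes refl = inj₁ refl
    ...   | no h≢h₀  = inj₂ (inj₂ (inj₁ (□-adjʳ g₀ (≢-sym h≢h₀))))
    dominated g h | inj₂ (inj₂ refl) with h ≟ h₀
    ...   | yes refl = inj₂ (inj₁ refl)
    ...   | no h≢h₀  = inj₂ (inj₂ (inj₂ (□-adjʳ g₁ (≢-sym h≢h₀))))

  row-pair⇒p≡2 : ∀ {g₀ h₀ h₁} → h₀ ≢ h₁ → (∀ g h → g ≡ g₀ ⊎ h ≡ h₀ ⊎ h ≡ h₁) →
                 OptimalPeggingNumber (K m □ K n) 2
  row-pair⇒p≡2 {g₀} h₀≢h₁ covered =
    dominating-edge⇒p≡2 (⟨,⟩-≢ʳ h₀≢h₁) (□-adjʳ g₀ h₀≢h₁) (□-adjʳ g₀ (≢-sym h₀≢h₁))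
      (row-pair-dominating covered)

  col-pair⇒p≡2 : ∀ {g₀ g₁ h₀} → g₀ ≢ g₁ → (∀ g h → h ≡ h₀ ⊎ g ≡ g₀ ⊎ g ≡ g₁) →
                 OptimalPeggingNumber (K m □ K n) 2
  col-pair⇒p≡2 {h₀ = h₀} g₀≢g₁ covered =
    dominating-edge⇒p≡2 (⟨,⟩-≢ˡ g₀≢g₁) (□-adjˡ h₀ g₀≢g₁) (□-adjˡ h₀ (≢-sym g₀≢g₁))
      (col-pair-dominating covered)

  no-dominating-pair : 3 ≤ m → 3 ≤ n → ∀ a b → ∃ λ t → ¬ InClosedNbhd a b t
  no-dominating-pair 3≤m 3≤n = ⟨,⟩-elim λ ga ha → ⟨,⟩-elim (undominated ga ha)
    where
    undominated : ∀ ga ha gb hb → ∃ λ t → ¬ InClosedNbhd ⟨ ga , ha ⟩ ⟨ gb , hb ⟩ t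
    undominated ga ha gb hb with ∃≢₂ 3≤m ga gb | ∃≢₂ 3≤n ha hb
    ... | g , g≢ga , g≢gb | h , h≢ha , h≢hb = ⟨ g , h ⟩ , λ where
      (inj₁ t≡a)               → ⟨,⟩-≢ˡ g≢ga t≡a
      (inj₂ (inj₁ t≡b))        → ⟨,⟩-≢ˡ g≢gb t≡b
      (inj₂ (inj₂ (inj₁ a~t))) → [ g≢ga ∘ sym , h≢ha ∘ sym ] (□-adj⇒≡ˡ⊎≡ʳ a~t)
      (inj₂ (inj₂ (inj₂ b~t))) → [ g≢gb ∘ sym , h≢hb ∘ sym ] (□-adj⇒≡ˡ⊎≡ʳ b~t)

module _ {m n : ℕ} where

  open Pegging (K (2 + m) □ K (2 + n))
  open Rook {2 + m} {2 + n}

  private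
    A B C : Fin ((2 + m) * (2 + n))
    A = ⟨ zero , zero ⟩
    B = ⟨ zero , suc zero ⟩
    C = ⟨ suc zero , zero ⟩

    A≢B : A ≢ B
    A≢B = ⟨,⟩-≢ʳ (λ ())

    A≢C : A ≢ C
    A≢C = ⟨,⟩-≢ˡ (λ ())

    B≢C : B ≢ C
    B≢C = ⟨,⟩-≢ˡ (λ ())

  corner : Distribution (K (2 + m) □ K (2 + n))
  corner = ⁅ A ⁆ ∪ ⁅ B ⁆ ∪ ⁅ C ⁆

  ∣corner∣≡3 : ∣ corner ∣ ≡ 3
  ∣corner∣≡3 =
    trans (x∉p⇒∣⁅x⁆∪p∣≡1+∣p∣ (x≢y∧x∉p⇒x∉⁅y⁆∪p A≢B (x≢y⇒x∉⁅y⁆ A≢C))) (cong suc (∣⁅x⁆∪⁅y⁆∣≡2 B≢C))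

  -- (0,2+h) is reached by C over A, (1,1+h) by A over C, (2+g,0) by B over A,
  -- and (2+g,1+h) by B over A followed by C over the peg just landed on (2+g,0).
  corner-solvable : Solvable (K (2 + m) □ K (2 + n)) corner
  corner-solvable = ⟨,⟩-elim reach
    where
    A∈ : A ∈ corner
    A∈ = x∈p∪q⁺ (inj₁ (x∈⁅x⁆ _))
    B∈ : B ∈ corner
    B∈ = x∈p∪q⁺ (inj₂ (x∈p∪q⁺ (inj₁ (x∈⁅x⁆ _))))
    C∈ : C ∈ corner
    C∈ = x∈p∪q⁺ (inj₂ (x∈p∪q⁺ (inj₂ (x∈⁅x⁆ _))))
    ∉corner : ∀ {t} → t ≢ A → t ≢ B → t ≢ C → t ∉ corner
    ∉corner t≢A t≢B t≢C = x≢y∧x∉p⇒x∉⁅y⁆∪p t≢A (x≢y∧x∉p⇒x∉⁅y⁆∪p t≢B (x≢y⇒x∉⁅y⁆ t≢C))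
    reach : ∀ g h → Reachable (K (2 + m) □ K (2 + n)) corner ⟨ g , h ⟩
    reach zero zero = corner , ε , A∈
    reach zero (suc zero) = corner , ε , B∈
    reach (suc zero) zero = corner , ε , C∈
    reach zero (suc (suc h)) =
      jump-reachable C∈ A∈ (⟨,⟩-≢ˡ (λ ())) (□-adjˡ zero (λ ()))
        (∉corner (⟨,⟩-≢ʳ (λ ())) (⟨,⟩-≢ʳ (λ ())) (⟨,⟩-≢ˡ (λ ()))) (□-adjʳ zero (λ ()))
    reach (suc zero) (suc h) =
      jump-reachable A∈ C∈ (⟨,⟩-≢ˡ (λ ())) (□-adjˡ zero (λ ()))
        (∉corner (⟨,⟩-≢ˡ (λ ())) (⟨,⟩-≢ˡ (λ ())) (⟨,⟩-≢ʳ (λ ()))) (□-adjʳ (suc zero) (λ ()))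
    reach (suc (suc g)) zero =
      jump-reachable B∈ A∈ (⟨,⟩-≢ʳ (λ ())) (□-adjʳ zero (λ ()))
        (∉corner (⟨,⟩-≢ˡ (λ ())) (⟨,⟩-≢ˡ (λ ())) (⟨,⟩-≢ˡ (λ ()))) (□-adjˡ zero (λ ()))
    reach (suc (suc g)) (suc h) = _ , B-over-A ◅ C-over-s ◅ ε , w∈jump
      where
      s : Fin ((2 + m) * (2 + n))
      s = ⟨ suc (suc g) , zero ⟩
      B-over-A : Move (K (2 + m) □ K (2 + n)) corner (jump corner _ _ s)
      B-over-A = jump-move B∈ A∈ (⟨,⟩-≢ʳ (λ ())) (□-adjʳ zero (λ ()))
                   (∉corner (⟨,⟩-≢ˡ (λ ())) (⟨,⟩-≢ˡ (λ ())) (⟨,⟩-≢ˡ (λ ()))) (□-adjˡ zero (λ ()))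
      C-over-s : Move (K (2 + m) □ K (2 + n)) (jump corner _ _ s) (jump (jump corner _ _ s) _ s _)
      C-over-s = jump-move (∈jump⁺ C∈ (⟨,⟩-≢ˡ (λ ())) (⟨,⟩-≢ˡ (λ ()))) w∈jump (⟨,⟩-≢ˡ (λ ()))
                   (□-adjˡ zero (λ ()))
                   (λ t∈ → ∉corner (⟨,⟩-≢ˡ (λ ())) (⟨,⟩-≢ˡ (λ ())) (⟨,⟩-≢ʳ (λ ()))
                             (∈jump∧≢⇒∈ t∈ (⟨,⟩-≢ʳ (λ ()))))
                   (□-adjʳ (suc (suc g)) (λ ()))

open Rook

p[K₁□K₁]≡1 : OptimalPeggingNumber (K 1 □ K 1) 1
p[K₁□K₁]≡1 = s≤s z≤n , (⁅ zero ⁆ , refl , λ { zero → ⁅ zero ⁆ , ε , here }) , λ _ 0<∣D∣ _ → 0<∣D∣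

p[K□K]≡2 : ∀ m n → 1 ≤ n → 1 < m * n → m ⊓ n ≤ 2 → OptimalPeggingNumber (K m □ K n) 2
p[K□K]≡2 0                     _                     _ ()
p[K□K]≡2 (suc _)               0                     ()
p[K□K]≡2 1                     1                     _ (s≤s ())
p[K□K]≡2 m@1                   n@(suc (suc _))       _ _ _ =
  row-pair⇒p≡2 {m} {n} {zero} {zero} {suc zero} (λ ()) λ { zero _ → inj₁ refl }
p[K□K]≡2 m@(suc (suc _))       n@1                   _ _ _ =
  col-pair⇒p≡2 {m} {n} {zero} {suc zero} {zero} (λ ()) λ { _ zero → inj₁ refl }
p[K□K]≡2 m@2                   n@(suc (suc _))       _ _ _ =
  col-pair⇒p≡2 {m} {n} {zero} {suc zero} {zero} (λ ())
    λ { zero _ → inj₂ (inj₁ refl) ; (suc zero) _ → inj₂ (inj₂ refl) }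
p[K□K]≡2 m@(suc (suc (suc _))) n@2                   _ _ _ =
  row-pair⇒p≡2 {m} {n} {zero} {zero} {suc zero} (λ ())
    λ { _ zero → inj₂ (inj₁ refl) ; _ (suc zero) → inj₂ (inj₂ refl) }
p[K□K]≡2 (suc (suc (suc _)))   (suc (suc (suc _)))   _ _ (s≤s (s≤s ()))

p[K□K]≡3 : ∀ {m n} → 3 ≤ m → 3 ≤ n → OptimalPeggingNumber (K m □ K n) 3
p[K□K]≡3 {suc (suc m)} {suc (suc n)} 3≤m@(s≤s (s≤s _)) 3≤n@(s≤s (s≤s _)) =
  Pegging.no-dominating-pair⇒p≡3 _ (no-dominating-pair 3≤m 3≤n) (corner {m} {n}) ∣corner∣≡3 corner-solvable

proposition4p2 : (m n : ℕ) → 1 ≤ m → 1 ≤ n →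
    (m * n ≡ 1 → OptimalPeggingNumber (K m □ K n) 1) ×
    (1 < m * n → m ⊓ n ≤ 2 → OptimalPeggingNumber (K m □ K n) 2) ×
    (2 < m ⊓ n → OptimalPeggingNumber (K m □ K n) 3)
proposition4p2 m n _ 1≤n =
  (λ mn≡1 → subst₂ (λ m n → OptimalPeggingNumber (K m □ K n) 1)
                   (sym (m*n≡1⇒m≡1 m n mn≡1)) (sym (m*n≡1⇒n≡1 m n mn≡1)) p[K₁□K₁]≡1) ,
  p[K□K]≡2 m n 1≤n ,
  λ 2<m⊓n → p[K□K]≡3 (≤-trans 2<m⊓n (m⊓n≤m m n)) (≤-trans 2<m⊓n (m⊓n≤n m n))
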